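{- Let $G=(V,E)$ be a finite simple undirected graph, let $k\ge 1$ with $k+1\le |V|$, and let $\{G^i=(V^i,E^i)\}_{i=1}^k$ be a $k$-partition of $G$. Then $$h_{k+1}(G)\ \ge\ \min_{i=1,2,\dots,k} h(G^i).$$
   Context: Graphs are finite, undirected, without loops or multiple edges. For $F\subset V$, $\partial F$ denotes the set of edges of $G$ with one endpoint in $F$ and the other in $V\setminus F$. The expansion constant is $h(G)=\min\{ |\partial F|/|F| : F\subset V,\ 1\le |F|\le |V|/2\}$ (for a graph with a single vertex the minimum is over the empty set and is taken to be $+\infty$). For $1\le k\le |V|$, the $k$-way expansion constant is $h_k(G)=\min\{\max_{i=1,\dots,k} |\partial V^i|/|V^i| : V=\bigsqcup_{i=1}^k V^i,\ V^i\neq\emptyset\}$, where $\partial V^i$ is taken in $G$. An induced subgraph $H$ of $G$ has vertex set $V_H\subset V$ and edge set $\{xy\in E: x,y\in V_H\}$. A $k$-partition of $G$ is a family of induced subgraphs $\{G^i=(V^i,E^i)\}_{i=1}^k$ of $G$ such that $V$ is the disjoint union of the $V^i$; $h(G^i)$ is the expansion constant of $G^i$ as a graph in its own right. -}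

module Defs where

open import Data.Bool using (Bool; true; false; _∧_; _∨_; not; if_then_else_)
open import Data.Bool.Properties using (∧-comm)
open import Data.Nat as ℕ using (ℕ; zero; suc; _+_; _*_; _≤ᵇ_)
open import Data.Fin using (Fin; zero; suc)
open import Data.List using (List; []; _∷_; map; concatMap; foldr)
open import Data.Integer using (+_)
open import Data.Rational using (ℚ; _/_; 0ℚ)
import Data.Rational as Q
open import Data.Product using (_×_; _,_)
open import Relation.Binary.PropositionalEquality using (_≡_; refl; cong; cong₂; trans)
open import Relation.Nullary.Decidable using (⌊_⌋)

VSet : ℕ → Set
VSet n = Fin n → Bool

sumF : ∀ {n} → (Fin n → ℕ) → ℕ
sumF {zero}  f = 0
sumF {suc n} f = f zero + sumF (λ x → f (suc x))

count : ∀ {n} → (Fin n → Bool) → ℕ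
count P = sumF (λ x → if P x then 1 else 0)

allFinᵇ : ∀ {k} → (Fin k → Bool) → Bool
allFinᵇ {zero}  P = true
allFinᵇ {suc k} P = P zero ∧ allFinᵇ (λ i → P (suc i))

_==_ : ∀ {k} → Fin k → Fin k → Bool
zero  == zero  = true
suc i == suc j = i == j
_     == _     = false

-- A finite simple undirected graph: vertex set V ⊆ Fin n (any finite
-- set can be so represented), a symmetric irreflexive adjacency relation,
-- edges only between vertices of V.

record Graph (n : ℕ) : Set where
  field
    V      : VSet n
    adj    : Fin n → Fin n → Bool
    sym    : ∀ x y → adj x y ≡ adj y x
    irrefl : ∀ x → adj x x ≡ false
    closed : ∀ x y → adj x y ≡ true → V x ≡ true
open Graph public

order : ∀ {n} → Graph n → ℕ
order G = count (V G)

-- |∂F| : number of edges of G with one endpoint in F and the other in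
-- V ∖ F; each such edge xy is counted exactly once, as the ordered pair
-- (x , y) with x ∈ F ∩ V, y ∈ V ∖ F.
boundary : ∀ {n} → Graph n → VSet n → ℕ
boundary G F =
  sumF (λ x → if F x ∧ V G x
                then count (λ y → V G y ∧ not (F y) ∧ adj G x y)
                else 0)

private
  ∧-true-l : ∀ a b → a ∧ b ≡ true → a ≡ true
  ∧-true-l true b _ = refl

  ∧-true-r : ∀ a b → a ∧ b ≡ true → b ≡ true
  ∧-true-r true true _ = refl

  ∧-false-l : ∀ a b → a ≡ false → a ∧ b ≡ false
  ∧-false-l false b _ = refl

induced : ∀ {n} → Graph n → VSet n → Graph n
induced {n} G S = record
  { V      = λ x → V G x ∧ S x
  ; adj    = λ x y → adj G x y ∧ (S x ∧ S y)
  ; sym    = λ x y → cong₂ _∧_ (Graph.sym G x y) (∧-comm (S x) (S y))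
  ; irrefl = λ x → ∧-false-l (adj G x x) _ (irrefl G x)
  ; closed = cl
  }
  where
  cl : ∀ x y → adj G x y ∧ (S x ∧ S y) ≡ true → V G x ∧ S x ≡ true
  cl x y e with adj G x y in eq | S x
  ... | true | true = trans (cong (_∧ true) (closed G x y eq)) refl

data ℚ∞ : Set where
  fin : ℚ → ℚ∞
  ∞   : ℚ∞

min∞ : ℚ∞ → ℚ∞ → ℚ∞
min∞ (fin p) (fin q) = fin (p Q.⊓ q)
min∞ (fin p) ∞       = fin p
min∞ ∞       q       = q

max∞ : ℚ∞ → ℚ∞ → ℚ∞
max∞ (fin p) (fin q) = fin (p Q.⊔ q)
max∞ (fin p) ∞       = ∞
max∞ ∞       q       = ∞

data _≤∞_ : ℚ∞ → ℚ∞ → Set where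
  fin≤fin : ∀ {p q} → p Q.≤ q → fin p ≤∞ fin q
  _≤∞∞    : ∀ x → x ≤∞ ∞

minimum∞ : List ℚ∞ → ℚ∞
minimum∞ = foldr min∞ ∞

minFin : ∀ {k} → (Fin k → ℚ∞) → ℚ∞
minFin {zero}  f = ∞
minFin {suc k} f = min∞ (f zero) (minFin (λ i → f (suc i)))

-- max_{i : Fin k} f i   (all values here are ≥ 0, so 0 is the unit)
maxFin : ∀ {k} → (Fin k → ℚ∞) → ℚ∞
maxFin {zero}  f = fin 0ℚ
maxFin {suc k} f = max∞ (f zero) (maxFin (λ i → f (suc i)))

-- a / b as a rational (only used with b ≥ 1)
ratio : ℕ → ℕ → ℚ
ratio a zero    = 0ℚ
ratio a (suc b) = (+ a) / suc b

allSets : ∀ n → List (VSet n)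
allSets zero    = (λ ()) ∷ []
allSets (suc n) = concatMap (λ S → ext false S ∷ ext true S ∷ []) (allSets n)
  where
  ext : Bool → VSet n → VSet (suc n)
  ext b S zero    = b
  ext b S (suc x) = S x

allMaps : ∀ k n → List (Fin n → Fin k)
allMaps k zero    = (λ ()) ∷ []
allMaps k (suc n) = concatMap (λ f → map (λ i → ext i f) (allFins k)) (allMaps k n)
  where
  allFins : ∀ k → List (Fin k)
  allFins zero    = []
  allFins (suc k) = zero ∷ map suc (allFins k)
  ext : Fin k → (Fin n → Fin k) → Fin (suc n) → Fin k
  ext i f zero    = i
  ext i f (suc x) = f x

-- Expansion constant
--   h(G) = min { |∂F|/|F| : F ⊆ V, 1 ≤ |F| ≤ |V|/2 }   (min ∅ = +∞).

h : ∀ {n} → Graph n → ℚ∞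
h {n} G = minimum∞ (map val (allSets n))
  where
  admissible : VSet n → Bool
  admissible F = (count (λ x → F x ∧ not (V G x)) ≤ᵇ 0)   -- F ⊆ V
               ∧ (1 ≤ᵇ count F)
               ∧ (2 * count F ≤ᵇ order G)
  val : VSet n → ℚ∞
  val F = if admissible F then fin (ratio (boundary G F) (count F)) else ∞

part : ∀ {n k} → Graph n → (Fin n → Fin k) → Fin k → VSet n
part G p i x = V G x ∧ (p x == i)

-- k-way expansion constant
--   h_k(G) = min over partitions V = V^1 ⊔ … ⊔ V^k with all V^i ≠ ∅
--            of max_i |∂V^i|/|V^i|.
-- A partition is encoded by the map p : vertex ↦ index of its part.
hk : ∀ {n} → Graph n → (k : ℕ) → ℚ∞
hk {n} G k = minimum∞ (map val (allMaps k n))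
  where
  val : (Fin n → Fin k) → ℚ∞
  val p = if allFinᵇ (λ i → 1 ≤ᵇ count (part G p i))
            then maxFin (λ i → fin (ratio (boundary G (part G p i))
                                          (count (part G p i))))
            else ∞

-- Let m = min_i h(G^i) and let U^0, …, U^k be any partition of V into
-- k+1 nonempty sets.  The traces U^j ∩ V^i are pairwise disjoint inside
-- each block V^i, so by the pigeonhole principle some U^j has at most half
-- of every block: 2·|U^j ∩ V^i| ≤ |V^i| for all i.  Each nonempty trace
-- is then admissible in the definition of h(G^i), so
-- |∂_{G^i}(U^j ∩ V^i)| ≥ m·|U^j ∩ V^i|.  Summing over i, the boundaries
-- inside the blocks are part of the boundary of U^j in G, and the traces
-- add up to U^j, hence |∂U^j|/|U^j| ≥ m, and so the maximum over the
-- parts is ≥ m.  Since the partition was arbitrary, h_{k+1}(G) ≥ m.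

module Submission where

open import Defs
open import Data.Bool using (Bool; true; false; _∧_; not; if_then_else_)
open import Data.Nat using (ℕ; zero; suc; _+_; _*_; _≤ᵇ_; _≤_; _<_; z≤n; s≤s)
import Data.Nat.Properties as NP
open import Data.Bool.Properties using (T-≡)
open import Function.Bundles using (Equivalence)
open import Algebra.Properties.CommutativeSemigroup NP.+-commutativeSemigroup
  using (interchange)
open import Data.Fin using (Fin; zero; suc) renaming (_<_ to _<ᶠ_)
import Data.Fin.Properties as FP
open import Data.List using (List; []; _∷_; map)
import Data.List.Relation.Unary.Any as Any
open import Data.List.Relation.Unary.Any using (here; there)
open import Data.List.Relation.Unary.Any.Properties using (concatMap⁺)
open import Data.List.Membership.Propositional using (_∈_)
open import Data.Product using (Σ; ∃; ∃₂; _×_; _,_; proj₁; proj₂)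
open import Data.Sum using (_⊎_; inj₁; inj₂)
open import Data.Empty using (⊥; ⊥-elim)
open import Relation.Nullary using (yes; no)
open import Relation.Binary.PropositionalEquality
  using (_≡_; _≢_; refl; cong; cong₂; trans; subst; subst₂; module ≡-Reasoning)
  renaming (sym to ≡-sym)
open import Data.Rational using (ℚ; ↥_; ↧_)
import Data.Rational as Q
import Data.Rational.Properties as QP
import Data.Rational.Unnormalised as U
import Data.Rational.Unnormalised.Properties as UP
import Data.Integer as Z
import Data.Integer.Properties as ZP

≤∞-refl : ∀ {a} → a ≤∞ a
≤∞-refl {fin p} = fin≤fin QP.≤-refl
≤∞-refl {∞}     = ∞ ≤∞∞

≤∞-trans : ∀ {a b c} → a ≤∞ b → b ≤∞ c → a ≤∞ c
≤∞-trans (fin≤fin p) (fin≤fin q) = fin≤fin (QP.≤-trans p q)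
≤∞-trans {a} _ (_ ≤∞∞) = a ≤∞∞

min∞-≤ˡ : ∀ a b → min∞ a b ≤∞ a
min∞-≤ˡ (fin p) (fin q) = fin≤fin (QP.p⊓q≤p p q)
min∞-≤ˡ (fin p) ∞       = ≤∞-refl
min∞-≤ˡ ∞       b       = b ≤∞∞

min∞-≤ʳ : ∀ a b → min∞ a b ≤∞ b
min∞-≤ʳ (fin p) (fin q) = fin≤fin (QP.p⊓q≤q p q)
min∞-≤ʳ (fin p) ∞       = fin p ≤∞∞
min∞-≤ʳ ∞       b       = ≤∞-refl

min∞-glb : ∀ {x a b} → x ≤∞ a → x ≤∞ b → x ≤∞ min∞ a b
min∞-glb (fin≤fin p) (fin≤fin q) = fin≤fin (QP.⊓-glb p q)
min∞-glb (fin≤fin p) (_ ≤∞∞)     = fin≤fin p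
min∞-glb (_ ≤∞∞)     x≤b         = x≤b

max∞-≥ˡ : ∀ {x a} b → x ≤∞ a → x ≤∞ max∞ a b
max∞-≥ˡ (fin q) (fin≤fin p) = fin≤fin (QP.≤-trans p (QP.p≤p⊔q _ q))
max∞-≥ˡ ∞       (fin≤fin p) = _ ≤∞∞
max∞-≥ˡ b       (_ ≤∞∞)     = _ ≤∞∞

max∞-≥ʳ : ∀ {x} a {b} → x ≤∞ b → x ≤∞ max∞ a b
max∞-≥ʳ (fin p) (fin≤fin q) = fin≤fin (QP.≤-trans q (QP.p≤q⊔p p _))
max∞-≥ʳ (fin p) (_ ≤∞∞)     = _ ≤∞∞
max∞-≥ʳ ∞       _           = _ ≤∞∞

minFin-≤ : ∀ {k} (f : Fin k → ℚ∞) i → minFin f ≤∞ f i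
minFin-≤ f zero    = min∞-≤ˡ (f zero) _
minFin-≤ f (suc i) = ≤∞-trans (min∞-≤ʳ (f zero) _) (minFin-≤ (λ i → f (suc i)) i)

maxFin-≥ : ∀ {k x} (f : Fin k → ℚ∞) i → x ≤∞ f i → x ≤∞ maxFin f
maxFin-≥ f zero    x≤f = max∞-≥ˡ _ x≤f
maxFin-≥ f (suc i) x≤f = max∞-≥ʳ (f zero) (maxFin-≥ (λ i → f (suc i)) i x≤f)

minimum∞-glb : ∀ {A : Set} {x} (val : A → ℚ∞) (L : List A) →
               (∀ a → x ≤∞ val a) → x ≤∞ minimum∞ (map val L)
minimum∞-glb val []      x≤ = _ ≤∞∞
minimum∞-glb val (a ∷ L) x≤ = min∞-glb (x≤ a) (minimum∞-glb val L x≤)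

minimum∞-≤ : ∀ {A : Set} (val : A → ℚ∞) {L : List A} {a} →
             a ∈ L → minimum∞ (map val L) ≤∞ val a
minimum∞-≤ val {b ∷ L} (here refl) = min∞-≤ˡ (val b) _
minimum∞-≤ val {b ∷ L} (there a∈L) =
  ≤∞-trans (min∞-≤ʳ (val b) _) (minimum∞-≤ val a∈L)

-- Pointwise equality of predicates; the enumeration of subsets only
-- produces sets up to this (function extensionality is not available).
_≐_ : ∀ {n} → VSet n → VSet n → Set
S ≐ T = ∀ x → S x ≡ T x

_⊆_ : ∀ {n} → VSet n → VSet n → Set
S ⊆ T = ∀ x → S x ≡ true → T x ≡ true

allSets-complete : ∀ n (F : VSet n) → Σ (VSet n) λ S → S ∈ allSets n × S ≐ F
allSets-complete zero    F = _ , here refl , λ ()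
allSets-complete (suc n) F with allSets-complete n (λ x → F (suc x))
... | S , S∈ , S≐ with F zero in F0
...   | false = _ , concatMap⁺ _ (Any.map (λ { refl → here refl }) S∈)
                  , λ { zero → ≡-sym F0 ; (suc x) → S≐ x }
...   | true  = _ , concatMap⁺ _ (Any.map (λ { refl → there (here refl) }) S∈)
                  , λ { zero → ≡-sym F0 ; (suc x) → S≐ x }

sumF-cong : ∀ {n} {f g : Fin n → ℕ} → (∀ x → f x ≡ g x) → sumF f ≡ sumF g
sumF-cong {zero}  f≡g = refl
sumF-cong {suc n} f≡g = cong₂ _+_ (f≡g zero) (sumF-cong (λ x → f≡g (suc x)))

sumF-mono : ∀ {n} {f g : Fin n → ℕ} → (∀ x → f x ≤ g x) → sumF f ≤ sumF g
sumF-mono {zero}  f≤g = z≤n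
sumF-mono {suc n} f≤g = NP.+-mono-≤ (f≤g zero) (sumF-mono (λ x → f≤g (suc x)))

sumF-zero : ∀ n → sumF {n} (λ _ → 0) ≡ 0
sumF-zero zero    = refl
sumF-zero (suc n) = sumF-zero n

sumF-+ : ∀ {n} (f g : Fin n → ℕ) → sumF (λ x → f x + g x) ≡ sumF f + sumF g
sumF-+ {zero}  f g = refl
sumF-+ {suc n} f g =
  trans (cong (f zero + g zero +_) (sumF-+ (λ x → f (suc x)) (λ x → g (suc x))))
        (interchange (f zero) (g zero) _ _)

sumF-swap : ∀ {n k} (f : Fin k → Fin n → ℕ) →
            sumF (λ x → sumF (λ i → f i x)) ≡ sumF (λ i → sumF (f i))
sumF-swap {n} {zero}  f = sumF-zero n
sumF-swap {n} {suc k} f =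
  trans (sumF-+ (f zero) (λ x → sumF (λ i → f (suc i) x)))
        (cong (sumF (f zero) +_) (sumF-swap (λ i → f (suc i))))

sumF-delta : ∀ {k} (j : Fin k) (a : Fin k → ℕ) →
             sumF (λ i → if j == i then a i else 0) ≡ a j
sumF-delta {suc k} zero    a = trans (cong (a zero +_) (sumF-zero k)) (NP.+-identityʳ _)
sumF-delta {suc k} (suc j) a = sumF-delta j (λ i → a (suc i))

⟦_⟧ : Bool → ℕ
⟦ b ⟧ = if b then 1 else 0

count-cong : ∀ {n} {A B : VSet n} → A ≐ B → count A ≡ count B
count-cong A≐B = sumF-cong (λ y → cong ⟦_⟧ (A≐B y))

count-mono : ∀ {n} {A B : VSet n} → A ⊆ B → count A ≤ count B
count-mono {A = A} {B} A⊆B = sumF-mono (λ y → pointwise (A y) (B y) (A⊆B y))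
  where
  pointwise : ∀ a b → (a ≡ true → b ≡ true) → ⟦ a ⟧ ≤ ⟦ b ⟧
  pointwise false b _   = z≤n
  pointwise true  b a⇒b rewrite a⇒b refl = NP.≤-refl

count-empty : ∀ {n} (A : VSet n) → (∀ y → A y ≡ false) → count A ≡ 0
count-empty {n} A empty = trans (sumF-cong (λ y → cong ⟦_⟧ (empty y))) (sumF-zero n)

count-disjoint : ∀ {n} {A B C : VSet n} → (∀ y → A y ≡ true → B y ≡ true → ⊥) →
                 A ⊆ C → B ⊆ C → count A + count B ≤ count C
count-disjoint {A = A} {B} {C} disj A⊆C B⊆C =
  subst (_≤ count C) (sumF-+ (λ y → ⟦ A y ⟧) (λ y → ⟦ B y ⟧))
        (sumF-mono (λ y → pointwise (A y) (B y) (C y) (disj y) (A⊆C y) (B⊆C y)))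
  where
  pointwise : ∀ a b c → (a ≡ true → b ≡ true → ⊥) → (a ≡ true → c ≡ true) →
              (b ≡ true → c ≡ true) → ⟦ a ⟧ + ⟦ b ⟧ ≤ ⟦ c ⟧
  pointwise false false c _ _   _   = z≤n
  pointwise true  false c _ a⇒c _   rewrite a⇒c refl = NP.≤-refl
  pointwise false true  c _ _   b⇒c rewrite b⇒c refl = NP.≤-refl
  pointwise true  true  c d _   _   = ⊥-elim (d refl refl)

≤ratio⇒cross : ∀ r b c → r Q.≤ ratio b (suc c) →
               (↥ r) Z.* (Z.+ suc c) Z.≤ (Z.+ b) Z.* (↧ r)
≤ratio⇒cross r@record{} b c r≤
  with UP.≤-respʳ-≃ (QP.toℚᵘ-fromℚᵘ (U.mkℚᵘ (Z.+ b) c))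
                    (QP.toℚᵘ-mono-≤ {r} {ratio b (suc c)} r≤)
... | U.*≤* cross = cross

cross⇒≤ratio : ∀ r b c → (↥ r) Z.* (Z.+ suc c) Z.≤ (Z.+ b) Z.* (↧ r) →
               r Q.≤ ratio b (suc c)
cross⇒≤ratio r@record{} b c cross = QP.toℚᵘ-cancel-≤
  (UP.≤-respʳ-≃ (UP.≃-sym (QP.toℚᵘ-fromℚᵘ (U.mkℚᵘ (Z.+ b) c))) (U.*≤* cross))

-- b/c ≥ m, vacuously true when c = 0 (the lower bound for a sum of
-- ratios must ignore empty summands).
RatioBound : ℚ∞ → ℕ → ℕ → Set
RatioBound m b c = c ≡ 0 ⊎ m ≤∞ fin (ratio b c)

ratioBound-antitone : ∀ {m m' b c} → m' ≤∞ m → RatioBound m b c → RatioBound m' b c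
ratioBound-antitone m'≤m (inj₁ c≡0) = inj₁ c≡0
ratioBound-antitone m'≤m (inj₂ m≤) = inj₂ (≤∞-trans m'≤m m≤)

ratioBound-mono : ∀ {m b b' c} → RatioBound m b c → b ≤ b' → RatioBound m b' c
ratioBound-mono {c = zero} _ _ = inj₁ refl
ratioBound-mono (inj₁ c≡0) _ = inj₁ c≡0
ratioBound-mono {fin r} {b} {b'} {suc c} (inj₂ (fin≤fin r≤)) b≤b' =
  inj₂ (fin≤fin (cross⇒≤ratio r b' c
    (ZP.≤-trans (≤ratio⇒cross r b c r≤) (ZP.*-monoʳ-≤-nonNeg (↧ r) (Z.+≤+ b≤b')))))

ratioBound-+ : ∀ {m b₁ c₁ b₂ c₂} → RatioBound m b₁ c₁ → RatioBound m b₂ c₂ →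
               RatioBound m (b₁ + b₂) (c₁ + c₂)
ratioBound-+ {b₁ = b₁} {zero} {b₂} _ bound₂ = ratioBound-mono bound₂ (NP.m≤n+m b₂ b₁)
ratioBound-+ {b₁ = b₁} {suc c₁} {b₂} {zero} bound₁ _
  rewrite NP.+-identityʳ c₁ = ratioBound-mono bound₁ (NP.m≤m+n b₁ b₂)
ratioBound-+ {fin r} {b₁} {suc c₁} {b₂} {suc c₂} (inj₂ (fin≤fin r≤₁)) (inj₂ (fin≤fin r≤₂)) =
  inj₂ (fin≤fin (cross⇒≤ratio r (b₁ + b₂) (c₁ + suc c₂)
    (subst₂ Z._≤_ (≡-sym (ZP.*-distribˡ-+ (↥ r) (Z.+ suc c₁) (Z.+ suc c₂)))
                  (≡-sym (ZP.*-distribʳ-+ (↧ r) (Z.+ b₁) (Z.+ b₂)))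
                  (ZP.+-mono-≤ (≤ratio⇒cross r b₁ c₁ r≤₁) (≤ratio⇒cross r b₂ c₂ r≤₂)))))

ratioBound-sum : ∀ {m k} (b c : Fin k → ℕ) → (∀ i → RatioBound m (b i) (c i)) →
                 RatioBound m (sumF b) (sumF c)
ratioBound-sum {k = zero}  b c bounds = inj₁ refl
ratioBound-sum {k = suc k} b c bounds =
  ratioBound-+ (bounds zero)
               (ratioBound-sum (λ i → b (suc i)) (λ i → c (suc i)) (λ i → bounds (suc i)))

expansionRatio : ∀ {n} → Graph n → VSet n → ℚ
expansionRatio H F = ratio (boundary H F) (count F)

boundary-cong : ∀ {n} (H : Graph n) {S T : VSet n} → S ≐ T → boundary H S ≡ boundary H T
boundary-cong H {S} {T} S≐T = sumF-cong pointwise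
  where
  pointwise : ∀ x → (if S x ∧ V H x then count (λ y → V H y ∧ not (S y) ∧ adj H x y) else 0)
                  ≡ (if T x ∧ V H x then count (λ y → V H y ∧ not (T y) ∧ adj H x y) else 0)
  pointwise x rewrite S≐T x =
    cong (λ z → if T x ∧ V H x then z else 0)
         (count-cong (λ y → cong (λ w → V H y ∧ not w ∧ adj H x y) (S≐T y)))

≤⇒≤ᵇ-true : ∀ {a b} → a ≤ b → (a ≤ᵇ b) ≡ true
≤⇒≤ᵇ-true a≤b = Equivalence.to T-≡ (NP.≤⇒≤ᵇ a≤b)

≤ᵇ-true⇒≤ : ∀ a b → (a ≤ᵇ b) ≡ true → a ≤ b
≤ᵇ-true⇒≤ a b t = NP.≤ᵇ⇒≤ a b (Equivalence.from T-≡ t)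

h-≤ : ∀ {n} (H : Graph n) (F : VSet n) → F ⊆ V H → 1 ≤ count F → 2 * count F ≤ order H →
      h H ≤∞ fin (expansionRatio H F)
h-≤ {n} H F F⊆V 1≤|F| 2|F|≤|V| with allSets-complete n F
... | S , S∈ , S≐F = ≤∞-trans (minimum∞-≤ _ S∈) admissible
  where
  |S|≡|F| : count S ≡ count F
  |S|≡|F| = count-cong S≐F

  S∖V-empty : ∀ x → S x ∧ not (V H x) ≡ false
  S∖V-empty x rewrite S≐F x with F x in Fx
  ... | false = refl
  ... | true rewrite F⊆V x Fx = refl

  admissible : (if (count (λ x → S x ∧ not (V H x)) ≤ᵇ 0)
                    ∧ (1 ≤ᵇ count S) ∧ (2 * count S ≤ᵇ order H)
                  then fin (expansionRatio H S) else ∞)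
               ≤∞ fin (expansionRatio H F)
  admissible
    rewrite count-empty _ S∖V-empty | |S|≡|F|
          | ≤⇒≤ᵇ-true 1≤|F| | ≤⇒≤ᵇ-true 2|F|≤|V| | boundary-cong H S≐F = ≤∞-refl

h-ratioBound : ∀ {n} (H : Graph n) (F : VSet n) → F ⊆ V H → 2 * count F ≤ order H →
               RatioBound (h H) (boundary H F) (count F)
h-ratioBound H F F⊆V 2|F|≤|V| with count F in |F|
... | zero  = inj₁ refl
... | suc _ = inj₂ (subst (λ c → h H ≤∞ fin (ratio (boundary H F) c)) |F|
                      (h-≤ H F F⊆V (subst (1 ≤_) (≡-sym |F|) (s≤s z≤n))
                                   (subst (λ c → 2 * c ≤ order H) (≡-sym |F|) 2|F|≤|V|)))

allFinᵇ-true : ∀ {k} (P : Fin k → Bool) → allFinᵇ P ≡ true → ∀ i → P i ≡ true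
allFinᵇ-true {suc k} P all zero    with P zero
... | true = refl
allFinᵇ-true {suc k} P all (suc i) with P zero
... | true = allFinᵇ-true (λ i → P (suc i)) all i

hk-≥ : ∀ {n} (G : Graph n) (K : ℕ) {m : ℚ∞} →
       (∀ (q : Fin n → Fin K) → (∀ j → 1 ≤ count (part G q j)) →
          m ≤∞ maxFin (λ j → fin (expansionRatio G (part G q j)))) →
       m ≤∞ hk G K
hk-≥ {n} G K {m} bound = minimum∞-glb _ (allMaps K n) boundIfNonempty
  where
  boundIfNonempty : ∀ q → m ≤∞ (if allFinᵇ (λ j → 1 ≤ᵇ count (part G q j))
                                   then maxFin (λ j → fin (expansionRatio G (part G q j)))
                                   else ∞)
  boundIfNonempty q with allFinᵇ (λ j → 1 ≤ᵇ count (part G q j)) in nonempty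
  ... | false = _ ≤∞∞
  ... | true  = bound q (λ j → ≤ᵇ-true⇒≤ 1 _ (allFinᵇ-true _ nonempty j))

block : ∀ {n k} → Graph n → (Fin n → Fin k) → Fin k → Graph n
block G p i = induced G (part G p i)

trace : ∀ {n k} → VSet n → (Fin n → Fin k) → Fin k → VSet n
trace U p i x = U x ∧ (p x == i)

part-⊆ : ∀ {n k} (G : Graph n) (q : Fin n → Fin k) j → part G q j ⊆ V G
part-⊆ G q j x t with V G x
... | true = refl

==⇒≡ : ∀ {k} {i j : Fin k} → i == j ≡ true → i ≡ j
==⇒≡ {i = zero}  {zero}  _ = refl
==⇒≡ {i = suc i} {suc j} e = cong suc (==⇒≡ e)

module _ {n k : ℕ} (G : Graph n) (p : Fin n → Fin k) where

  trace⊆block : ∀ U → U ⊆ V G → ∀ i → trace U p i ⊆ V (block G p i)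
  trace⊆block U U⊆V i x t with U x in Ux | p x == i
  ... | true | true rewrite U⊆V x Ux = refl

  count-traces : ∀ U → sumF (λ i → count (trace U p i)) ≡ count U
  count-traces U = begin
    sumF (λ i → sumF (λ x → ⟦ U x ∧ (p x == i) ⟧))              ≡⟨ ≡-sym (sumF-swap (λ i x → ⟦ U x ∧ (p x == i) ⟧)) ⟩
    sumF (λ x → sumF (λ i → ⟦ U x ∧ (p x == i) ⟧))              ≡⟨ sumF-cong (λ x → sumF-cong (indicator x)) ⟩
    sumF (λ x → sumF (λ i → if p x == i then ⟦ U x ⟧ else 0))   ≡⟨ sumF-cong (λ x → sumF-delta (p x) _) ⟩
    count U                                                      ∎
    where
    open ≡-Reasoning
    indicator : ∀ x i → ⟦ U x ∧ (p x == i) ⟧ ≡ (if p x == i then ⟦ U x ⟧ else 0)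
    indicator x i with U x | p x == i
    ... | false | false = refl
    ... | false | true  = refl
    ... | true  | false = refl
    ... | true  | true  = refl

  boundaryAt : VSet n → Fin n → ℕ
  boundaryAt U x =
    if U x ∧ V G x then count (λ y → V G y ∧ not (U y) ∧ adj G x y) else 0

  -- An edge leaving the trace of U inside a block also leaves U in G.
  boundaryAt-trace : ∀ U i x →
    (if trace U p i x ∧ V (block G p i) x
       then count (λ y → V (block G p i) y ∧ not (trace U p i y) ∧ adj (block G p i) x y)
       else 0)
    ≤ (if p x == i then boundaryAt U x else 0)
  boundaryAt-trace U i x with U x | p x == i | V G x
  ... | false | _     | _     = z≤n
  ... | true  | false | _     = z≤n
  ... | true  | true  | false = z≤n
  ... | true  | true  | true  = count-mono (λ y → leaving (V G y) (p y == i) (U y) (adj G x y))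
    where
    leaving : ∀ v e u a → (v ∧ (v ∧ e)) ∧ not (u ∧ e) ∧ (a ∧ (v ∧ e)) ≡ true →
              v ∧ not u ∧ a ≡ true
    leaving true true false true _ = refl

  -- The boundaries of the traces inside the blocks are disjoint parts of ∂U.
  boundary-traces : ∀ U → sumF (λ i → boundary (block G p i) (trace U p i)) ≤ boundary G U
  boundary-traces U = begin
    sumF (λ i → sumF (λ x → inside i x))                        ≡⟨ ≡-sym (sumF-swap inside) ⟩
    sumF (λ x → sumF (λ i → inside i x))                        ≤⟨ sumF-mono (λ x → sumF-mono (λ i → boundaryAt-trace U i x)) ⟩
    sumF (λ x → sumF (λ i → if p x == i then boundaryAt U x else 0)) ≡⟨ sumF-cong (λ x → sumF-delta (p x) _) ⟩
    boundary G U                                                ∎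
    where
    open NP.≤-Reasoning
    inside : Fin k → Fin n → ℕ
    inside i x =
      if trace U p i x ∧ V (block G p i) x
        then count (λ y → V (block G p i) y ∧ not (trace U p i y) ∧ adj (block G p i) x y)
        else 0

  traces-disjoint : ∀ {K} (q : Fin n → Fin K) {j j'} → j ≢ j' → ∀ i →
    count (trace (part G q j) p i) + count (trace (part G q j') p i) ≤ order (block G p i)
  traces-disjoint q {j} {j'} j≢j' i =
    count-disjoint disjoint
      (trace⊆block (part G q j) (part-⊆ G q j) i)
      (trace⊆block (part G q j') (part-⊆ G q j') i)
    where
    inPart : ∀ {j} x → trace (part G q j) p i x ≡ true → q x ≡ j
    inPart {j} x t with V G x | q x == j in qx | p x == i
    ... | true | true | true = ==⇒≡ qx
    disjoint : ∀ x → trace (part G q j) p i x ≡ true → trace (part G q j') p i x ≡ true → ⊥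
    disjoint x t t' = j≢j' (trans (≡-sym (inPart x t)) (inPart x t'))

halves-overlap : ∀ o a b → o < 2 * a → o < 2 * b → a + b ≤ o → ⊥
halves-overlap o a b o<2a o<2b a+b≤o = NP.<-irrefl refl (begin-strict
  o + o          <⟨ NP.+-mono-< o<2a o<2b ⟩
  2 * a + 2 * b  ≡⟨ ≡-sym (NP.*-distribˡ-+ 2 a b) ⟩
  2 * (a + b)    ≤⟨ NP.*-monoʳ-≤ 2 a+b≤o ⟩
  2 * o          ≡⟨ cong (o +_) (NP.+-identityʳ o) ⟩
  o + o          ∎)
  where open NP.≤-Reasoning

at-most-half-somewhere : ∀ {k K} (o : Fin k → ℕ) (c : Fin K → Fin k → ℕ) → k < K →
  (∀ {j j'} → j ≢ j' → ∀ i → c j i + c j' i ≤ o i) →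
  ∃ λ j → ∀ i → 2 * c j i ≤ o i
at-most-half-somewhere {k} {K} o c k<K disjoint
  with FP.any? (λ j → FP.all? (λ i → 2 * c j i NP.≤? o i))
... | yes small = small
... | no ¬small = ⊥-elim (collision (FP.pigeonhole k<K (λ j → proj₁ (large j))))
  where
  large : ∀ j → ∃ λ i → o i < 2 * c j i
  large j with FP.¬∀⟶∃¬ k _ (λ i → 2 * c j i NP.≤? o i) (λ all → ¬small (j , all))
  ... | i , ¬≤ = i , NP.≰⇒> ¬≤

  collision : (∃₂ λ j j' → j <ᶠ j' × proj₁ (large j) ≡ proj₁ (large j')) → ⊥
  collision (j , j' , j<j' , same) =
    halves-overlap (o i) (c j i) (c j' i)
                   (proj₂ (large j))
                   (subst (λ i → o i < 2 * c j' i) (≡-sym same) (proj₂ (large j')))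
                   (disjoint (FP.<⇒≢ j<j') i)
    where i = proj₁ (large j)

-- Key estimate: a set that is at most half of every block expands at
-- least as well as the worst block: summing the per-block bounds
-- |∂_{G^i}(U ∩ V^i)| ≥ m·|U ∩ V^i| over the blocks gives |∂U| ≥ m·|U|.
small-set-expansion : ∀ {n k} (G : Graph n) (p : Fin n → Fin k) (U : VSet n) →
  U ⊆ V G → (∀ i → 2 * count (trace U p i) ≤ order (block G p i)) →
  RatioBound (minFin (λ i → h (block G p i))) (boundary G U) (count U)
small-set-expansion G p U U⊆V small =
  ratioBound-mono (subst (RatioBound _ _) (count-traces G p U) summed)
                  (boundary-traces G p U)
  where
  perBlock : ∀ i → RatioBound (minFin (λ i → h (block G p i)))
                              (boundary (block G p i) (trace U p i)) (count (trace U p i))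
  perBlock i = ratioBound-antitone (minFin-≤ _ i)
    (h-ratioBound (block G p i) (trace U p i) (trace⊆block G p U U⊆V i) (small i))
  summed : RatioBound (minFin (λ i → h (block G p i)))
                      (sumF (λ i → boundary (block G p i) (trace U p i)))
                      (sumF (λ i → count (trace U p i)))
  summed = ratioBound-sum _ _ perBlock

-- Among the parts of any
-- (k+1)-partition into nonempty sets, one is at most half of every block
-- of p, and that part alone already has expansion ratio ≥ min_i h(G^i).
lemma1 : ∀ {n} (G : Graph n) (k : ℕ) → 1 ≤ k → k + 1 ≤ order G →
         (p : Fin n → Fin k) →
         minFin (λ i → h (induced G (part G p i))) ≤∞ hk G (k + 1)
lemma1 G k _ _ p = hk-≥ G (k + 1) bound
  where
  bound : ∀ q → (∀ j → 1 ≤ count (part G q j)) →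
          minFin (λ i → h (block G p i)) ≤∞ maxFin (λ j → fin (expansionRatio G (part G q j)))
  bound q nonempty with at-most-half-somewhere (λ i → order (block G p i))
                          (λ j i → count (trace (part G q j) p i))
                          (NP.m<m+n k (s≤s z≤n)) (traces-disjoint G p q)
  ... | j , small with small-set-expansion G p (part G q j) (part-⊆ G q j) small
  ...   | inj₂ m≤ = maxFin-≥ _ j m≤
  ...   | inj₁ |U|≡0 = ⊥-elim (NP.<⇒≢ (nonempty j) (≡-sym |U|≡0))
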